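{- Let $k\ge 1$ be an integer and let $A$ be the sequence defined by $A(1)=A(2)=1$ and $$A(n) = A\big(A^k(n-1)\big) + A\big(n-A^k(n-1)\big) \quad (n\ge 3),$$ where $A^k$ denotes the $k$-fold composition of $A$. Let $E_n$ be defined by $E_n=1$ for $1\le n\le k$ and $E_n=E_{n-1}+E_{n-k}$ for $n>k$. Then $A(E_n)=E_{n-1}$ for all $n\ge 2$. -}

module Defs where

open import Data.Nat using (ℕ; zero; suc; _+_; _∸_; _≤_; _<_)
open import Relation.Binary.PropositionalEquality using (_≡_)
open import Data.Product using (_×_)

_^[_] : (ℕ → ℕ) → ℕ → (ℕ → ℕ)
(f ^[ zero ]) x = x
(f ^[ suc k ]) x = f ((f ^[ k ]) x)

IsASeq : ℕ → (ℕ → ℕ) → Set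
IsASeq k A =
  (A 1 ≡ 1) × (A 2 ≡ 1) ×
  (∀ n → 3 ≤ n → A n ≡ A ((A ^[ k ]) (n ∸ 1)) + A (n ∸ (A ^[ k ]) (n ∸ 1)))

IsESeq : ℕ → (ℕ → ℕ) → Set
IsESeq k E =
  (∀ n → 1 ≤ n → n ≤ k → E n ≡ 1) ×
  (∀ n → k < n → E n ≡ E (n ∸ 1) + E (n ∸ k))

module Submission where

open import Defs
open import Data.Nat using (ℕ; _≤_; _∸_)
open import Relation.Binary.PropositionalEquality using (_≡_)

open import Data.Nat using (zero; suc; _+_; _<_; z≤n; s≤s; s≤s⁻¹; _≤′_; ≤′-refl; ≤′-step)
open import Data.Nat.Properties
open import Data.Empty using (⊥-elim)
open import Data.Product using (_×_; _,_; proj₁; proj₂)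
open import Data.Sum using (_⊎_; inj₁; inj₂)
open import Relation.Binary.PropositionalEquality
  using (refl; sym; trans; cong; cong₂; subst; subst₂; module ≡-Reasoning)
open import Relation.Nullary using (Dec; yes; no; ¬_)
open import Relation.Nullary.Decidable using (_⊎-dec_)

-- First, A is slow: A 1 = 1 and A(y+1) - A(y) ∈ {0, 1}. This follows by
-- course-of-values induction, since the recurrences at n and n + 1 differ in a single summand,
-- which takes a unit step because iterates of a slow function are slow. Slowness makes A and
-- G = A^k monotone with 1 ≤ A y ≤ y, and it lets upper and lower bounds be carried from one
-- level E_{j+1} to the next E_j along A whenever A(E_{j+1}) = E_j ("chains").
-- Second, by course-of-values induction over the levels n we prove A(E_{n+1}) = E_n together
-- with A(E_{n+1} - 1) = E_n for the levels outside the window (k, 2k). For n > k, with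
-- S = E_{n+1-k}, the point x scans from E_n - 1 up to E_{n+1} - 1 maintaining
-- A x ≤ E_n, G x ≤ S and x + 1 ≤ E_n + G x; at the end G x = S, so the recurrence gives
-- A(E_{n+1}) = A(S) + A(E_n) = E_{n-k} + E_{n-1} = E_n.

iterate-+ : (f : ℕ → ℕ) → ∀ i j y → (f ^[ i + j ]) y ≡ (f ^[ i ]) ((f ^[ j ]) y)
iterate-+ f zero    j y = refl
iterate-+ f (suc i) j y = cong f (iterate-+ f i j y)

iterate-peel : (f : ℕ → ℕ) → ∀ {k} j y → j ≤ k → (f ^[ k ]) y ≡ (f ^[ k ∸ j ]) ((f ^[ j ]) y)
iterate-peel f {k} j y j≤k =
  trans (cong (λ i → (f ^[ i ]) y) (sym (m∸n+n≡m j≤k))) (iterate-+ f (k ∸ j) j y)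

iterate-suc : (f : ℕ → ℕ) → ∀ i y → (f ^[ suc i ]) y ≡ (f ^[ i ]) (f y)
iterate-suc f i y = trans (cong (λ j → (f ^[ j ]) y) (+-comm 1 i)) (iterate-+ f i 1 y)

Below : (ℕ → Set) → ℕ → Set
Below P n = ∀ j → 1 ≤ j → j < n → P j

below-induction : (P : ℕ → Set) → (∀ n → 1 ≤ n → Below P n → P n) → ∀ n → Below P n
below-induction P step zero    j _   ()
below-induction P step (suc n) j j≥1 j<1+n with m<1+n⇒m<n∨m≡n j<1+n
... | inj₁ j<n  = below-induction P step n j j≥1 j<n
... | inj₂ refl = step j j≥1 (below-induction P step j)

stepwise-mono : (g : ℕ → ℕ) → (∀ y → 1 ≤ y → g y ≤ g (suc y)) →
                ∀ {a b} → 1 ≤ a → a ≤ b → g a ≤ g b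
stepwise-mono g up {a} a≥1 a≤b = go (≤⇒≤′ a≤b)
  where
  go : ∀ {b} → a ≤′ b → g a ≤ g b
  go ≤′-refl          = ≤-refl
  go (≤′-step {b} a≤b) = ≤-trans (go a≤b) (up b (≤-trans a≥1 (≤′⇒≤ a≤b)))

UnitStep : ℕ → ℕ → Set
UnitStep a b = b ≡ a ⊎ b ≡ suc a

Step : (ℕ → ℕ) → ℕ → Set
Step f y = UnitStep (f y) (f (suc y))

unitStep-≤ : ∀ {a b} → UnitStep a b → a ≤ b
unitStep-≤ (inj₁ refl) = ≤-refl
unitStep-≤ (inj₂ refl) = n≤1+n _

unitStep-≤suc : ∀ {a b} → UnitStep a b → b ≤ suc a
unitStep-≤suc (inj₁ refl) = n≤1+n _
unitStep-≤suc (inj₂ refl) = ≤-refl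

unitStep-squeeze : ∀ {a b} → a ≤ b → b ≤ suc a → UnitStep a b
unitStep-squeeze a≤b b≤1+a with m≤n⇒m<n∨m≡n a≤b
... | inj₁ a<b  = inj₂ (≤-antisym b≤1+a a<b)
... | inj₂ refl = inj₁ refl

unitStep-+ˡ : ∀ c {a b} → UnitStep a b → UnitStep (c + a) (c + b)
unitStep-+ˡ c (inj₁ b≡a)  = inj₁ (cong (c +_) b≡a)
unitStep-+ˡ c (inj₂ b≡1+a) = inj₂ (trans (cong (c +_) b≡1+a) (+-suc c _))

unitStep-+ʳ : ∀ c {a b} → UnitStep a b → UnitStep (a + c) (b + c)
unitStep-+ʳ c (inj₁ b≡a)  = inj₁ (cong (_+ c) b≡a)
unitStep-+ʳ c (inj₂ b≡1+a) = inj₂ (cong (_+ c) b≡1+a)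

module SlowOn (f : ℕ → ℕ) (f1 : f 1 ≡ 1) {N : ℕ} (slow : Below (Step f) N) where

  bounded : ∀ a → 1 ≤ a → a ≤ N → 1 ≤ f a × f a ≤ a
  bounded 1 _ _ = ≤-reflexive (sym f1) , ≤-reflexive f1
  bounded (suc (suc a)) _ a+2≤N
    with bounded (suc a) (s≤s z≤n) (≤-trans (n≤1+n _) a+2≤N) | slow (suc a) (s≤s z≤n) a+2≤N
  ... | pos , le | inj₁ same rewrite same = pos , m≤n⇒m≤1+n le
  ... | pos , le | inj₂ up   rewrite up   = m≤n⇒m≤1+n pos , s≤s le

  iterate-bounded : ∀ i a → 1 ≤ a → a ≤ N → 1 ≤ (f ^[ i ]) a × (f ^[ i ]) a ≤ a
  iterate-bounded zero    a a≥1 _   = a≥1 , ≤-refl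
  iterate-bounded (suc i) a a≥1 a≤N with iterate-bounded i a a≥1 a≤N
  ... | pos , le with bounded _ pos (≤-trans le a≤N)
  ...   | pos′ , le′ = pos′ , ≤-trans le′ le

  iterate-slow : ∀ i → Below (Step (f ^[ i ])) N
  iterate-slow zero    a _   _   = inj₂ refl
  iterate-slow (suc i) a a≥1 a<N with iterate-slow i a a≥1 a<N | iterate-bounded i a a≥1 (<⇒≤ a<N)
  ... | inj₁ same | _         = inj₁ (cong f same)
  ... | inj₂ up   | pos , le rewrite up = slow _ pos (≤-trans (s≤s le) a<N)

module Slow (f : ℕ → ℕ) (f1 : f 1 ≡ 1) (slow : ∀ y → 1 ≤ y → Step f y) where

  private
    module Up-to (N : ℕ) = SlowOn f f1 {N} (λ y y≥1 _ → slow y y≥1)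

  pos : ∀ {a} → 1 ≤ a → 1 ≤ f a
  pos {a} a≥1 = proj₁ (Up-to.bounded a a a≥1 ≤-refl)

  sub-identity : ∀ {a} → 1 ≤ a → f a ≤ a
  sub-identity {a} a≥1 = proj₂ (Up-to.bounded a a a≥1 ≤-refl)

  mono : ∀ {a b} → 1 ≤ a → a ≤ b → f a ≤ f b
  mono = stepwise-mono f (λ y y≥1 → unitStep-≤ (slow y y≥1))

  lipschitz : ∀ d {a} → 1 ≤ a → f (d + a) ≤ f a + d
  lipschitz zero    {a} _   = ≤-reflexive (sym (+-identityʳ (f a)))
  lipschitz (suc d) {a} a≥1 = begin
    f (suc (d + a)) ≤⟨ unitStep-≤suc (slow (d + a) (≤-trans a≥1 (m≤n+m a d))) ⟩
    suc (f (d + a)) ≤⟨ s≤s (lipschitz d a≥1) ⟩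
    suc (f a + d)   ≡⟨ +-suc (f a) d ⟨
    f a + suc d     ∎
    where open ≤-Reasoning

  slow-bound : ∀ {y z} e → 1 ≤ y → 1 ≤ z → z ≤ y + e → f z ≤ f y + e
  slow-bound {y} {z} e y≥1 z≥1 z≤y+e with z ≤? y
  ... | yes z≤y = ≤-trans (mono z≥1 z≤y) (m≤m+n (f y) e)
  ... | no  z≰y = begin
    f z               ≡⟨ cong f (m∸n+n≡m y≤z) ⟨
    f (z ∸ y + y)     ≤⟨ lipschitz (z ∸ y) y≥1 ⟩
    f y + (z ∸ y)     ≤⟨ +-monoʳ-≤ (f y) (m≤n+o⇒m∸n≤o z y z≤y+e) ⟩
    f y + e           ∎
    where
    open ≤-Reasoning
    y≤z : y ≤ z
    y≤z = <⇒≤ (≰⇒> z≰y)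

  iterate-pos : ∀ i {a} → 1 ≤ a → 1 ≤ (f ^[ i ]) a
  iterate-pos i {a} a≥1 = proj₁ (Up-to.iterate-bounded a i a a≥1 ≤-refl)

  iterate-below : ∀ i {a} → 1 ≤ a → (f ^[ i ]) a ≤ a
  iterate-below i {a} a≥1 = proj₂ (Up-to.iterate-bounded a i a a≥1 ≤-refl)

  iterate-mono : ∀ i {a b} → 1 ≤ a → a ≤ b → (f ^[ i ]) a ≤ (f ^[ i ]) b
  iterate-mono zero    _   a≤b = a≤b
  iterate-mono (suc i) a≥1 a≤b = mono (iterate-pos i a≥1) (iterate-mono i a≥1 a≤b)

-- The sequence A is slow: by course-of-values induction, the recurrence at n and n + 1
-- differs in exactly one summand, and that summand takes a unit step.
module ASlow (k : ℕ) (k≥1 : 1 ≤ k) (A : ℕ → ℕ) (A1 : A 1 ≡ 1) (A2 : A 2 ≡ 1)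
  (rec : ∀ n → 3 ≤ n → A n ≡ A ((A ^[ k ]) (n ∸ 1)) + A (n ∸ (A ^[ k ]) (n ∸ 1))) where

  G : ℕ → ℕ
  G = A ^[ k ]

  iterate-at-2 : ∀ i → 1 ≤ i → (A ^[ i ]) 2 ≡ 1
  iterate-at-2 1             _ = A2
  iterate-at-2 (suc (suc i)) _ = trans (cong A (iterate-at-2 (suc i) (s≤s z≤n))) A1

  G-at-2 : G 2 ≡ 1
  G-at-2 = iterate-at-2 k k≥1

  A-at-3 : A 3 ≡ 2
  A-at-3 = begin
    A 3                   ≡⟨ rec 3 ≤-refl ⟩
    A (G 2) + A (3 ∸ G 2) ≡⟨ cong (λ s → A s + A (3 ∸ s)) G-at-2 ⟩
    A 1 + A 2             ≡⟨ cong₂ _+_ A1 A2 ⟩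
    2                     ∎
    where open ≡-Reasoning

  -- With s = G(n-1), G n is s or s + 1 since iterates of A are slow below n. In the first case
  -- A(n+1) - A(n) = A(n+1-s) - A(n-s), in the second A(n+1) - A(n) = A(s+1) - A(s).
  step-from-below : ∀ n → 1 ≤ n → Below (Step A) n → Step A n
  step-from-below 1 _ _ = inj₁ (trans A2 (sym A1))
  step-from-below 2 _ _ = inj₂ (trans A-at-3 (cong suc (sym A2)))
  step-from-below (suc (suc (suc m))) _ slow = by-G-step (SlowOn.iterate-slow A A1 slow k n₀ (s≤s z≤n) ≤-refl)
    where
    n₀ n s : ℕ
    n₀ = suc (suc m)
    n  = suc n₀
    s  = G n₀
    s-bounds : 1 ≤ s × s ≤ n₀
    s-bounds = SlowOn.iterate-bounded A A1 slow k n₀ (s≤s z≤n) (n≤1+n n₀)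
    rec-n : A n ≡ A s + A (n ∸ s)
    rec-n = rec n (s≤s (s≤s (s≤s z≤n)))
    rec-1+n : ∀ {s′} → G n ≡ s′ → A (suc n) ≡ A s′ + A (suc n ∸ s′)
    rec-1+n {s′} G-n = trans (rec (suc n) (s≤s (s≤s (s≤s z≤n)))) (cong (λ t → A t + A (suc n ∸ t)) G-n)
    by-G-step : UnitStep s (G n) → Step A n
    by-G-step (inj₁ same) =
      subst₂ UnitStep (sym rec-n) (sym (trans (rec-1+n same) (cong (λ t → A s + A t) (+-∸-assoc 1 s≤n))))
        (unitStep-+ˡ (A s) (slow (n ∸ s) (m<n⇒0<n∸m (s≤s (proj₂ s-bounds))) (s≤s (∸-monoʳ-≤ n (proj₁ s-bounds)))))
      where
      s≤n : s ≤ n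
      s≤n = m≤n⇒m≤1+n (proj₂ s-bounds)
    by-G-step (inj₂ up) =
      subst₂ UnitStep (sym rec-n) (sym (rec-1+n up))
        (unitStep-+ʳ (A (n ∸ s)) (slow s (proj₁ s-bounds) (s≤s (proj₂ s-bounds))))

  A-slow : ∀ y → 1 ≤ y → Step A y
  A-slow y y≥1 = below-induction (Step A) step-from-below (suc y) y y≥1 ≤-refl

module ESeq (k : ℕ) (k≥1 : 1 ≤ k) (E : ℕ → ℕ) (E-init : ∀ n → 1 ≤ n → n ≤ k → E n ≡ 1)
  (E-rec : ∀ n → k < n → E n ≡ E (n ∸ 1) + E (n ∸ k)) where

  E-rec′ : ∀ j → E (suc j + k) ≡ E (j + k) + E (suc j)
  E-rec′ j = trans (E-rec (suc j + k) (s≤s (m≤n+m k j))) (cong (λ i → E (j + k) + E i) (m+n∸n≡m (suc j) k))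

  -- Inside the second block of length k the shift by k lands in the initial block.
  E-rec-init : ∀ {j} → k < j → j ≤ k + k → E j ≡ suc (E (j ∸ 1))
  E-rec-init {j} k<j j≤2k = begin
    E j                     ≡⟨ E-rec j k<j ⟩
    E (j ∸ 1) + E (j ∸ k)   ≡⟨ cong (E (j ∸ 1) +_) (E-init (j ∸ k) (m<n⇒0<n∸m k<j) (m≤n+o⇒m∸n≤o j k j≤2k)) ⟩
    E (j ∸ 1) + 1           ≡⟨ +-comm (E (j ∸ 1)) 1 ⟩
    suc (E (j ∸ 1))         ∎
    where open ≡-Reasoning

  E-step : ∀ j → 1 ≤ j → E j ≤ E (suc j)
  E-step j j≥1 with suc j ≤? k
  ... | yes 1+j≤k = ≤-reflexive (trans (E-init j j≥1 (<⇒≤ 1+j≤k)) (sym (E-init (suc j) (s≤s z≤n) 1+j≤k)))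
  ... | no  1+j≰k = ≤-trans (m≤m+n (E j) _) (≤-reflexive (sym (E-rec (suc j) (≰⇒> 1+j≰k))))

  E-mono : ∀ {i j} → 1 ≤ i → i ≤ j → E i ≤ E j
  E-mono = stepwise-mono E E-step

  E-pos : ∀ {j} → 1 ≤ j → 1 ≤ E j
  E-pos {j} j≥1 = subst (_≤ E j) (E-init 1 ≤-refl k≥1) (E-mono ≤-refl j≥1)

  E-after-k : E (suc k) ≡ 2
  E-after-k = trans (E-rec′ 0) (cong₂ _+_ (E-init k k≥1 ≤-refl) (E-init 1 ≤-refl k≥1))

  E≥2 : ∀ {j} → k < j → 2 ≤ E j
  E≥2 {j} k<j = subst (_≤ E j) E-after-k (E-mono (s≤s z≤n) k<j)

  E≥3 : ∀ {j} → suc k < j → 3 ≤ E j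
  E≥3 1+k<j = ≤-trans E-at-k+2 (E-mono (s≤s z≤n) 1+k<j)
    where
    E-at-k+2 : 3 ≤ E (suc (suc k))
    E-at-k+2 = subst (3 ≤_) (sym (E-rec′ 1)) (subst (λ v → 3 ≤ v + E 2) (sym E-after-k) (s≤s (s≤s (E-pos (s≤s z≤n)))))

module Chains (f : ℕ → ℕ) (f1 : f 1 ≡ 1) (slow : ∀ y → 1 ≤ y → Step f y)
  (E : ℕ → ℕ) (E-pos : ∀ {j} → 1 ≤ j → 1 ≤ E j) where

  open Slow f f1 slow

  Descends : ℕ → Set
  Descends j = f (E (suc j)) ≡ E j

  DescendsPred : ℕ → Set
  DescendsPred j = f (E (suc j) ∸ 1) ≡ E j

  Descending : ℕ → ℕ → Set
  Descending L T = ∀ j → L ≤ j → j < T → Descends j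

  level-up : ∀ {j y} → Descends j → 1 ≤ y → y ≤ E (suc j) → f y ≤ E j
  level-up {j} desc y≥1 y≤E = ≤-trans (mono y≥1 y≤E) (≤-reflexive desc)

  level-down : ∀ {j y} e → Descends j → 1 ≤ y → E (suc j) ≤ y + e → E j ≤ f y + e
  level-down e desc y≥1 E≤y+e = subst (_≤ _) desc (slow-bound e y≥1 (E-pos (s≤s z≤n)) E≤y+e)

  level-down-strict : ∀ {j y} e → Descends j → DescendsPred j → 1 ≤ y →
                      E (suc j) ≤ y + suc e → E j ≤ f y + e
  level-down-strict {j} {y} e desc descPred y≥1 E≤y+1+e with E (suc j) ≤? y
  ... | yes E≤y = level-down e desc y≥1 (≤-trans E≤y (m≤m+n y e))
  ... | no  E≰y = subst (_≤ _) descPred (slow-bound e y≥1 (≤-trans y≥1 y≤E-1) E-1≤y+e)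
    where
    y≤E-1 : y ≤ E (suc j) ∸ 1
    y≤E-1 = ∸-monoˡ-≤ 1 (≰⇒> E≰y)
    E-1≤y+e : E (suc j) ∸ 1 ≤ y + e
    E-1≤y+e = m≤n+o⇒m∸n≤o (E (suc j)) 1 (≤-trans E≤y+1+e (≤-reflexive (+-suc y e)))

  chain-up : ∀ i {L T y} → L + i ≡ T → Descending L T → 1 ≤ y → y ≤ E T → (f ^[ i ]) y ≤ E L
  chain-up zero    {L} {y = y} refl _    _   y≤E = subst (λ t → y ≤ E t) (+-identityʳ L) y≤E
  chain-up (suc i) {L} {y = y} refl desc y≥1 y≤E = subst (_≤ E L) (sym (iterate-suc f i y))
    (chain-up i refl (λ j L≤j j<L+i → desc j L≤j (<-≤-trans j<L+i L+i≤L+1+i)) (pos y≥1)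
      (level-up (desc (L + i) (m≤m+n L i) (+-monoʳ-< L ≤-refl)) y≥1 (subst (λ t → y ≤ E t) (+-suc L i) y≤E)))
    where
    L+i≤L+1+i : L + i ≤ L + suc i
    L+i≤L+1+i = +-monoʳ-≤ L (n≤1+n i)

  chain-down : ∀ i {L T y} e → L + i ≡ T → Descending L T → 1 ≤ y → E T ≤ y + e → E L ≤ (f ^[ i ]) y + e
  chain-down zero    {L} {y = y} e refl _    _   E≤y+e = subst (λ t → E t ≤ y + e) (+-identityʳ L) E≤y+e
  chain-down (suc i) {L} {y = y} e refl desc y≥1 E≤y+e = subst (λ v → E L ≤ v + e) (sym (iterate-suc f i y))
    (chain-down i e refl (λ j L≤j j<L+i → desc j L≤j (<-≤-trans j<L+i L+i≤L+1+i)) (pos y≥1)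
      (level-down e (desc (L + i) (m≤m+n L i) (+-monoʳ-< L ≤-refl)) y≥1 (subst (λ t → E t ≤ y + e) (+-suc L i) E≤y+e)))
    where
    L+i≤L+1+i : L + i ≤ L + suc i
    L+i≤L+1+i = +-monoʳ-≤ L (n≤1+n i)

module Main (k : ℕ) (k≥1 : 1 ≤ k) (A : ℕ → ℕ) (A1 : A 1 ≡ 1) (A2 : A 2 ≡ 1)
  (rec : ∀ n → 3 ≤ n → A n ≡ A ((A ^[ k ]) (n ∸ 1)) + A (n ∸ (A ^[ k ]) (n ∸ 1)))
  (E : ℕ → ℕ) (E-init : ∀ n → 1 ≤ n → n ≤ k → E n ≡ 1)
  (E-rec : ∀ n → k < n → E n ≡ E (n ∸ 1) + E (n ∸ k)) where

  open ASlow k k≥1 A A1 A2 rec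
  open Slow A A1 A-slow
  open ESeq k k≥1 E E-init E-rec
  open Chains A A1 A-slow E E-pos

  -- The levels at which A(E_{j+1} - 1) = E_j is claimed: all but those in the window (k, 2k).
  Good : ℕ → Set
  Good j = j ≤ k ⊎ k + k ≤ j

  good? : ∀ j → Dec (Good j)
  good? j = (j ≤? k) ⊎-dec (k + k ≤? j)

  Claim : ℕ → Set
  Claim j = Descends j × (Good j → 2 ≤ E (suc j) → DescendsPred j)

  shift-sum : ∀ j m → j ≤ k → (j + m) + (k ∸ j) ≡ m + k
  shift-sum j m j≤k = begin
    (j + m) + (k ∸ j) ≡⟨ cong (_+ (k ∸ j)) (+-comm j m) ⟩
    (m + j) + (k ∸ j) ≡⟨ +-assoc m j (k ∸ j) ⟩
    m + (j + (k ∸ j)) ≡⟨ cong (m +_) (m+[n∸m]≡n j≤k) ⟩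
    m + k             ∎
    where open ≡-Reasoning

  -- The inductive step at level n = m + k + 1 > k, assuming the claim at all levels in [1, n).
  -- With S = E_{m+2} = E_{n+1-k}, the recurrences E_n = E_{n-1} + E_{n-k} and
  -- E_{n+1} = E_n + S hold, and x runs from E_n - 1 to E_{n+1} - 1.
  module Level (m : ℕ) (ih : Below Claim (suc (m + k))) where

    n S e : ℕ
    n = suc (m + k)
    S = E (suc (suc m))
    e = E n ∸ 1

    descending : ∀ {L T} → 1 ≤ L → T ≤ n → Descending L T
    descending L≥1 T≤n j L≤j j<T = proj₁ (ih j (≤-trans L≥1 L≤j) (<-≤-trans j<T T≤n))

    descends-pred : ∀ {j} → 1 ≤ j → j < n → Good j → 2 ≤ E (suc j) → DescendsPred j
    descends-pred {j} j≥1 j<n = proj₂ (ih j j≥1 j<n)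

    m+k≥1 : 1 ≤ m + k
    m+k≥1 = ≤-trans k≥1 (m≤n+m k m)

    1+m<n : suc m < n
    1+m<n = s≤s (subst (_≤ m + k) (+-comm m 1) (+-monoʳ-≤ m k≥1))

    descends-top : A (E n) ≡ E (m + k)
    descends-top = proj₁ (ih (m + k) m+k≥1 ≤-refl)

    descends-S : A S ≡ E (suc m)
    descends-S = proj₁ (ih (suc m) (s≤s z≤n) 1+m<n)

    E-split : E n ≡ E (m + k) + E (suc m)
    E-split = E-rec′ m

    A-S+A-En : A S + A (E n) ≡ E n
    A-S+A-En = trans (cong₂ _+_ descends-S descends-top) (trans (+-comm (E (suc m)) _) (sym E-split))

    En≥2 : 2 ≤ E n
    En≥2 = E≥2 (s≤s (m≤n+m k m))

    1+e : suc e ≡ E n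
    1+e = m+[n∸m]≡n (≤-trans (s≤s z≤n) En≥2)

    e≥1 : 1 ≤ e
    e≥1 = s≤s⁻¹ (subst (2 ≤_) (sym 1+e) En≥2)

    S+e≥2 : ∀ {s} → 1 ≤ s → 2 ≤ s + e
    S+e≥2 s≥1 = +-mono-≤ s≥1 e≥1

    A-via : ∀ {x s p} → 2 ≤ x → G x ≡ s → suc x ∸ s ≡ p → A (suc x) ≡ A s + A p
    A-via x≥2 refl refl = rec (suc _) (s≤s x≥2)

    G-En : G (E n) ≤ E (suc m)
    G-En = chain-up k refl (descending (s≤s z≤n) ≤-refl) (E-pos (s≤s z≤n)) ≤-refl

    G-bound : ∀ {y} → 1 ≤ y → A y ≤ E n → G y ≤ S
    G-bound {y} y≥1 Ay≤En = subst (_≤ S) (sym (iterate-peel A 1 y k≥1))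
      (chain-up (k ∸ 1) (shift-sum 1 (suc m) k≥1) (descending (s≤s z≤n) ≤-refl) (pos y≥1) Ay≤En)

    chain-to-S : ∀ {y} d → 1 ≤ y → E n ≤ A y + d → S ≤ G y + d
    chain-to-S {y} d y≥1 En≤Ay+d = subst (λ v → S ≤ v + d) (sym (iterate-peel A 1 y k≥1))
      (chain-down (k ∸ 1) d (shift-sum 1 (suc m) k≥1) (descending (s≤s z≤n) ≤-refl) (pos y≥1) En≤Ay+d)

    chain-to-S-strict : ∀ {y} d → 2 ≤ k → Good (m + k) → 1 ≤ y → E n ≤ A y + suc d → S ≤ G y + d
    chain-to-S-strict {y} d 2≤k good y≥1 En≤Ay+1+d = subst (λ v → S ≤ v + d) (sym (iterate-peel A 2 y 2≤k))
      (chain-down (k ∸ 2) d (shift-sum 2 m 2≤k) (descending (s≤s z≤n) (n≤1+n _)) (pos (pos y≥1))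
        (level-down-strict d descends-top (descends-pred m+k≥1 ≤-refl good En≥2) (pos y≥1) En≤Ay+1+d))

    window-k≤m : ¬ Good (suc m) → k ≤ m
    window-k≤m ¬good = s≤s⁻¹ (≰⇒> (λ le → ¬good (inj₁ le)))

    window-2+m≤2k : ¬ Good (suc m) → suc (suc m) ≤ k + k
    window-2+m≤2k ¬good = ≰⇒> (λ le → ¬good (inj₂ le))

    window-k≥2 : ¬ Good (suc m) → 2 ≤ k
    window-k≥2 ¬good = +-cancelʳ-≤ m 2 k (≤-trans (window-2+m≤2k ¬good) (+-monoʳ-≤ k (window-k≤m ¬good)))

    window-top-good : ¬ Good (suc m) → Good (m + k)
    window-top-good ¬good = inj₂ (+-monoˡ-≤ k (window-k≤m ¬good))

    Invariant : ℕ → Set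
    Invariant x = A x ≤ E n × G x ≤ S × suc x ≤ E n + G x

    invariant-start : Invariant e
    invariant-start = A-e≤En , G-bound e≥1 A-e≤En , ≤-trans (≤-reflexive 1+e) (m≤m+n (E n) (G e))
      where
      A-e≤En : A e ≤ E n
      A-e≤En = ≤-trans (sub-identity e≥1) (≤-trans (n≤1+n e) (≤-reflexive 1+e))

    -- x = 2 is reached only when e = 1, below the range of the recurrence.
    invariant-at-2 : Invariant 2
    invariant-at-2 = ≤-trans (≤-reflexive A2) (≤-trans (s≤s z≤n) En≥2)
                   , ≤-trans (≤-reflexive G-at-2) (E-pos (s≤s z≤n))
                   , subst (λ v → 3 ≤ E n + v) (sym G-at-2) (subst (3 ≤_) (+-comm 1 (E n)) (s≤s En≥2))

    -- Write S = s + 1 + ε; the bound E_n ≤ A y + ε (with a unit of slack gained at level m + 1,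
    -- or at level m + k when m + 1 lies in the window) is carried down to S ≤ G y + ε.
    tight-growth : ∀ {s y} → 1 ≤ s → suc s ≤ S → 1 ≤ y → A y ≡ A s + E (m + k) → suc s ≤ G y
    tight-growth {s} {y} s≥1 1+s≤S y≥1 Ay = +-cancelʳ-≤ ε (suc s) (G y) (subst (_≤ G y + ε) S≡ S≤Gy+ε)
      where
      ε : ℕ
      ε = S ∸ suc s
      S≡ : S ≡ suc s + ε
      S≡ = sym (m+[n∸m]≡n 1+s≤S)
      S≤s+1+ε : S ≤ s + suc ε
      S≤s+1+ε = ≤-reflexive (trans S≡ (sym (+-suc s ε)))
      lift : ∀ d → E (suc m) ≤ A s + d → E n ≤ A y + d
      lift d le = begin
        E n                    ≡⟨ E-split ⟩
        E (m + k) + E (suc m)  ≤⟨ +-monoʳ-≤ (E (m + k)) le ⟩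
        E (m + k) + (A s + d)  ≡⟨ +-assoc (E (m + k)) (A s) d ⟨
        E (m + k) + A s + d    ≡⟨ cong (_+ d) (trans (+-comm (E (m + k)) (A s)) (sym Ay)) ⟩
        A y + d                ∎
        where open ≤-Reasoning
      S≤Gy+ε : S ≤ G y + ε
      S≤Gy+ε with good? (suc m)
      ... | yes good = chain-to-S ε y≥1 (lift ε
            (level-down-strict ε descends-S (descends-pred (s≤s z≤n) 1+m<n good (≤-trans (s≤s s≥1) 1+s≤S)) s≥1 S≤s+1+ε))
      ... | no ¬good = chain-to-S-strict ε (window-k≥2 ¬good) (window-top-good ¬good) y≥1
            (lift (suc ε) (level-down (suc ε) descends-S s≥1 S≤s+1+ε))

    cover : ∀ i → suc i ≤ S → 2 ≤ i + e → Invariant (i + e) → suc (suc (i + e)) ≤ E n + G (suc (i + e))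
    cover i 1+i≤S x≥2 (_ , _ , 1+x≤En+s) with suc (suc (i + e)) ≤? E n + G (i + e)
    ... | yes fits = ≤-trans fits (+-monoʳ-≤ (E n) (iterate-mono k (≤-trans (s≤s z≤n) x≥2) (n≤1+n _)))
    ... | no  tight = begin
      suc (suc x)      ≡⟨ cong suc 1+x≡ ⟩
      suc (E n + s)    ≡⟨ +-suc (E n) s ⟨
      E n + suc s      ≤⟨ +-monoʳ-≤ (E n) (tight-growth (iterate-pos k (≤-trans (s≤s z≤n) x≥2))
                            (subst (λ v → suc v ≤ S) (sym s≡i) 1+i≤S) (s≤s z≤n)
                            (trans (A-via x≥2 refl (trans (cong (_∸ s) 1+x≡) (m+n∸n≡m (E n) s)))
                                   (cong (A s +_) descends-top))) ⟩
      E n + G (suc x)  ∎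
      where
      open ≤-Reasoning
      x s : ℕ
      x = i + e
      s = G x
      1+x≡ : suc x ≡ E n + s
      1+x≡ = ≤-antisym 1+x≤En+s (s≤s⁻¹ (≰⇒> tight))
      s≡i : s ≡ i
      s≡i = +-cancelʳ-≡ (E n) s i (trans (+-comm s (E n)) (trans (sym 1+x≡)
              (trans (sym (+-suc i e)) (cong (i +_) 1+e))))

    invariant-step : ∀ i → suc i ≤ S → Invariant (i + e) → Invariant (suc (i + e))
    invariant-step i 1+i≤S inv@(_ , s≤S , 1+x≤En+s) with 2 ≤? i + e
    ... | no x≱2 = subst Invariant (cong suc (sym x≡1)) invariant-at-2
      where
      x≡1 : i + e ≡ 1
      x≡1 = ≤-antisym (s≤s⁻¹ (≰⇒> x≱2)) (≤-trans e≥1 (m≤n+m e i))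
    ... | yes x≥2 = A-x′≤En , G-bound (s≤s z≤n) A-x′≤En , cover i 1+i≤S x≥2 inv
      where
      x : ℕ
      x = i + e
      s-bounds : 1 ≤ G x × G x ≤ x
      s-bounds = iterate-pos k (≤-trans (s≤s z≤n) x≥2) , iterate-below k (≤-trans (s≤s z≤n) x≥2)
      A-x′≤En : A (suc x) ≤ E n
      A-x′≤En = subst (_≤ E n) (sym (A-via x≥2 refl refl))
        (≤-trans (+-mono-≤ (mono (proj₁ s-bounds) s≤S)
                           (mono (m<n⇒0<n∸m (s≤s (proj₂ s-bounds)))
                                 (m≤n+o⇒m∸n≤o (suc x) (G x) (subst (suc x ≤_) (+-comm (E n) (G x)) 1+x≤En+s))))
                 (≤-reflexive A-S+A-En))

    invariant : ∀ i → i ≤ S → Invariant (i + e)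
    invariant zero    _     = invariant-start
    invariant (suc i) 1+i≤S = invariant-step i 1+i≤S (invariant i (<⇒≤ 1+i≤S))

    -- At the end of the scan x = S + e = E_{n+1} - 1, and the invariant pins G x = S.
    1+S+e : suc (S + e) ≡ E n + S
    1+S+e = trans (sym (+-suc S e)) (trans (cong (S +_) 1+e) (+-comm S (E n)))

    E-next : E (suc n) ≡ suc (S + e)
    E-next = trans (E-rec′ (suc m)) (sym 1+S+e)

    G-end : G (S + e) ≡ S
    G-end with invariant S ≤-refl
    ... | _ , G≤S , cov = ≤-antisym G≤S (+-cancelˡ-≤ (E n) S _ (subst (_≤ E n + G (S + e)) 1+S+e cov))

    descends-n : Descends n
    descends-n = begin
      A (E (suc n))    ≡⟨ cong A E-next ⟩
      A (suc (S + e))  ≡⟨ A-via (S+e≥2 (E-pos (s≤s z≤n))) G-end (trans (cong (_∸ S) 1+S+e) (m+n∸n≡m (E n) S)) ⟩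
      A S + A (E n)    ≡⟨ A-S+A-En ⟩
      E n              ∎
      where open ≡-Reasoning

    -- When level m + 1 lies in the window, S = E_{m+1} + 1 and E_{m+1} = E_m + 1, and G already
    -- reaches S at the point S - 1 + e; this rules out one case for E_{n+1} - 1 below.
    module Window (¬good : ¬ Good (suc m)) where

      k≤m : k ≤ m
      k≤m = window-k≤m ¬good

      m≥1 : 1 ≤ m
      m≥1 = ≤-trans k≥1 k≤m

      S≡ : S ≡ suc (E (suc m))
      S≡ = E-rec-init (s≤s (m≤n⇒m≤1+n k≤m)) (window-2+m≤2k ¬good)

      E₁≡ : E (suc m) ≡ suc (E m)
      E₁≡ = E-rec-init (s≤s k≤m) (≤-trans (n≤1+n _) (window-2+m≤2k ¬good))

      descends-pred-top : A e ≡ E (m + k)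
      descends-pred-top = descends-pred m+k≥1 ≤-refl (window-top-good ¬good) En≥2

      G-e : E (suc m) ≤ G e
      G-e = subst (E (suc m) ≤_) (trans (+-identityʳ _) (sym (iterate-peel A 1 e k≥1)))
        (chain-down (k ∸ 1) 0 (shift-sum 1 m k≥1) (descending (s≤s z≤n) (n≤1+n _)) (pos e≥1)
          (≤-reflexive (trans (sym descends-pred-top) (sym (+-identityʳ (A e))))))

      Y : ℕ
      Y = suc (E m + e)

      G-before-Y : UnitStep (E (suc m)) (G (E m + e))
      G-before-Y = unitStep-squeeze
        (≤-trans G-e (iterate-mono k e≥1 (m≤n+m e (E m))))
        (subst (G (E m + e) ≤_) S≡ (proj₁ (proj₂ (invariant (E m) Em≤S))))
        where
        Em≤S : E m ≤ S
        Em≤S = ≤-trans (n≤1+n _) (≤-trans (≤-reflexive (sym E₁≡)) (E-step (suc m) (s≤s z≤n)))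

      A-Y-low : G (E m + e) ≡ E (suc m) → E n ≤ A Y + 1
      A-Y-low G≡ = ≤-reflexive (begin
        E n                      ≡⟨ E-split ⟩
        E (m + k) + E (suc m)    ≡⟨ cong (E (m + k) +_) E₁≡ ⟩
        E (m + k) + suc (E m)    ≡⟨ +-comm (E (m + k)) (suc (E m)) ⟩
        suc (E m + E (m + k))    ≡⟨ +-comm 1 _ ⟩
        E m + E (m + k) + 1      ≡⟨ cong (_+ 1) AY ⟨
        A Y + 1                  ∎)
        where
        open ≡-Reasoning
        AY : A Y ≡ E m + E (m + k)
        AY = trans (A-via (S+e≥2 (E-pos m≥1)) G≡ (trans (cong (Y ∸_) E₁≡) (m+n∸m≡n (E m) e)))
                   (cong₂ _+_ (proj₁ (ih m m≥1 (s≤s (m≤m+n m k)))) descends-pred-top)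

      A-Y-high : G (E m + e) ≡ suc (E (suc m)) → E n ≤ A Y + 1
      A-Y-high G≡ = begin
        E n                          ≡⟨ E-split ⟩
        E (m + k) + E (suc m)        ≡⟨ cong (_+ E (suc m)) descends-pred-top ⟨
        A e + E (suc m)              ≤⟨ +-monoˡ-≤ (E (suc m)) (slow-bound 1 e-1≥1 e≥1 e≤e-1+1) ⟩
        A (e ∸ 1) + 1 + E (suc m)    ≡⟨ +-comm (A (e ∸ 1) + 1) _ ⟩
        E (suc m) + (A (e ∸ 1) + 1)  ≡⟨ +-assoc (E (suc m)) _ 1 ⟨
        E (suc m) + A (e ∸ 1) + 1    ≡⟨ cong (_+ 1) AY ⟨
        A Y + 1                      ∎
        where
        open ≤-Reasoning
        e-1≥1 : 1 ≤ e ∸ 1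
        e-1≥1 = ∸-monoˡ-≤ 1 (s≤s⁻¹ (subst (3 ≤_) (sym 1+e) (E≥3 (s≤s (+-monoˡ-≤ k m≥1)))))
        e≤e-1+1 : e ≤ e ∸ 1 + 1
        e≤e-1+1 = ≤-trans (m≤n+m∸n e 1) (≤-reflexive (+-comm 1 (e ∸ 1)))
        AY : A Y ≡ E (suc m) + A (e ∸ 1)
        AY = trans (A-via (S+e≥2 (E-pos m≥1)) (trans G≡ (sym S≡)) (trans (cong (Y ∸_) S≡′) ([m+n]∸[m+o]≡n∸o (E m) e 1)))
                   (cong (_+ A (e ∸ 1)) descends-S)
          where
          S≡′ : S ≡ suc (E m + 1)
          S≡′ = trans S≡ (cong suc (trans E₁≡ (+-comm 1 (E m))))

      gap : S ≤ G ((S ∸ 1) + e)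
      gap = subst (λ t → S ≤ G t) (sym S-1+e≡Y) (subst (S ≤_) (+-identityʳ (G Y))
              (chain-to-S-strict 0 (window-k≥2 ¬good) (window-top-good ¬good) (s≤s z≤n) En≤AY+1))
        where
        S-1+e≡Y : (S ∸ 1) + e ≡ Y
        S-1+e≡Y = cong (λ t → (t ∸ 1) + e) (trans S≡ (cong suc E₁≡))
        En≤AY+1 : E n ≤ A Y + 1
        En≤AY+1 with G-before-Y
        ... | inj₁ G≡ = A-Y-low G≡
        ... | inj₂ G≡ = A-Y-high G≡

    good-n⇒k≤1+m : Good n → k ≤ suc m
    good-n⇒k≤1+m (inj₁ n≤k)  = ⊥-elim (1+n≰n (≤-trans (s≤s (m≤n+m k m)) n≤k))
    good-n⇒k≤1+m (inj₂ 2k≤n) = +-cancelʳ-≤ k k (suc m) 2k≤n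

    -- If level m + k is not good while n is, then m + 1 = k, S = 2 and G stays at 1 on E_n.
    top-window : Good n → ¬ Good (m + k) → G ((S ∸ 1) + e) < S
    top-window good ¬goodₜ = begin-strict
      G ((S ∸ 1) + e)  ≡⟨ cong G (trans (cong (λ t → (t ∸ 1) + e) S≡2) 1+e) ⟩
      G (E n)          ≤⟨ G-En ⟩
      E (suc m)        ≡⟨ trans (cong E 1+m≡k) (E-init k k≥1 ≤-refl) ⟩
      1                <⟨ s≤s (s≤s z≤n) ⟩
      2                ≡⟨ S≡2 ⟨
      S                ∎
      where
      open ≤-Reasoning
      1+m≡k : suc m ≡ k
      1+m≡k = ≤-antisym (+-cancelʳ-≤ k (suc m) k (≰⇒> (λ le → ¬goodₜ (inj₂ le)))) (good-n⇒k≤1+m good)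
      S≡2 : S ≡ 2
      S≡2 = trans (cong (λ j → E (suc j)) 1+m≡k) E-after-k

    -- Just below E_{n+1}: x = S₁ + e + 1 with S₁ = S - 1, and G (S₁ + e) is S₁ or S. In the
    -- first case level m + 1 must be good, in the second level m + k.
    descends-pred-n : Good n → DescendsPred n
    descends-pred-n good =
      trans (cong A E-next-1) (trans (A-via (S+e≥2 S₁≥1) refl refl) (by-G (unitStep-squeeze S₁≤s s≤1+S₁)))
      where
      S≥2 : 2 ≤ S
      S≥2 = E≥2 (s≤s (good-n⇒k≤1+m good))
      S₁ s : ℕ
      S₁ = S ∸ 1
      s  = G (S₁ + e)
      1+S₁ : suc S₁ ≡ S
      1+S₁ = m+[n∸m]≡n (≤-trans (s≤s z≤n) S≥2)
      S₁≥1 : 1 ≤ S₁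
      S₁≥1 = s≤s⁻¹ (subst (2 ≤_) (sym 1+S₁) S≥2)
      E-next-1 : E (suc n) ∸ 1 ≡ suc (S₁ + e)
      E-next-1 = trans (cong (_∸ 1) E-next) (cong (_+ e) (sym 1+S₁))
      inv : Invariant (S₁ + e)
      inv = invariant S₁ (subst (S₁ ≤_) 1+S₁ (n≤1+n S₁))
      s≤1+S₁ : s ≤ suc S₁
      s≤1+S₁ = subst (s ≤_) (sym 1+S₁) (proj₁ (proj₂ inv))
      S₁≤s : S₁ ≤ s
      S₁≤s = +-cancelˡ-≤ (E n) S₁ s (subst (_≤ E n + s) 1+S₁+e (proj₂ (proj₂ inv)))
        where
        1+S₁+e : suc (S₁ + e) ≡ E n + S₁
        1+S₁+e = trans (sym (+-suc S₁ e)) (trans (cong (S₁ +_) 1+e) (+-comm S₁ (E n)))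
      open ≡-Reasoning
      by-G : UnitStep S₁ s → A s + A (suc (S₁ + e) ∸ s) ≡ E n
      by-G (inj₁ s≡S₁) with good? (suc m)
      ... | no ¬good₁ = ⊥-elim (1+n≰n (subst (_≤ S₁) (sym 1+S₁) (subst (S ≤_) s≡S₁ (Window.gap ¬good₁))))
      ... | yes good₁ = begin
        A s + A (suc (S₁ + e) ∸ s)    ≡⟨ cong (λ t → A t + A (suc (S₁ + e) ∸ t)) s≡S₁ ⟩
        A S₁ + A (suc (S₁ + e) ∸ S₁)  ≡⟨ cong₂ (λ u v → u + A v) S₁-descends
                                          (trans (+-∸-assoc 1 (m≤m+n S₁ e)) (trans (cong suc (m+n∸m≡n S₁ e)) 1+e)) ⟩
        A S + A (E n)                 ≡⟨ A-S+A-En ⟩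
        E n                           ∎
        where
        S₁-descends : A S₁ ≡ A S
        S₁-descends = trans (descends-pred (s≤s z≤n) 1+m<n good₁ S≥2) (sym descends-S)
      by-G (inj₂ s≡1+S₁) with good? (m + k)
      ... | no ¬goodₜ = ⊥-elim (<-irrefl (trans s≡1+S₁ 1+S₁) (top-window good ¬goodₜ))
      ... | yes goodₜ = begin
        A s + A (suc (S₁ + e) ∸ s)          ≡⟨ cong (λ t → A t + A (suc (S₁ + e) ∸ t)) s≡1+S₁ ⟩
        A (suc S₁) + A (S₁ + e ∸ S₁)        ≡⟨ cong₂ (λ u v → A u + A v) 1+S₁ (m+n∸m≡n S₁ e) ⟩
        A S + A e                           ≡⟨ cong (A S +_) (trans (descends-pred m+k≥1 ≤-refl goodₜ En≥2) (sym descends-top)) ⟩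
        A S + A (E n)                       ≡⟨ A-S+A-En ⟩
        E n                                 ∎

  -- Levels j ≤ k: there E_j = 1, E_{j+1} ∈ {1, 2}, and A 1 = A 2 = 1.
  claim-at-k : Claim k
  claim-at-k = trans (cong A E-after-k) (trans A2 (sym Ek))
             , λ _ _ → trans (cong (λ v → A (v ∸ 1)) E-after-k) (trans A1 (sym Ek))
    where
    Ek : E k ≡ 1
    Ek = E-init k k≥1 ≤-refl

  claim-initial : ∀ j → 1 ≤ j → j ≤ k → Claim j
  claim-initial j j≥1 j≤k with suc j ≤? k
  ... | yes 1+j≤k = trans (cong A E₁) (trans A1 (sym (E-init j j≥1 j≤k)))
                  , λ _ E₁≥2 → ⊥-elim (1+n≰n (subst (2 ≤_) E₁ E₁≥2))
    where
    E₁ : E (suc j) ≡ 1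
    E₁ = E-init (suc j) (s≤s z≤n) 1+j≤k
  ... | no 1+j≰k = subst Claim (≤-antisym (s≤s⁻¹ (≰⇒> 1+j≰k)) j≤k) claim-at-k

  claim-step : ∀ j → 1 ≤ j → Below Claim j → Claim j
  claim-step j j≥1 below with j ≤? k
  ... | yes j≤k = claim-initial j j≥1 j≤k
  ... | no  j≰k = subst Claim j≡ (Level.descends-n m below′ , λ good _ → Level.descends-pred-n m below′ good)
    where
    m : ℕ
    m = j ∸ suc k
    j≡ : suc (m + k) ≡ j
    j≡ = trans (sym (+-suc m k)) (m∸n+n≡m (≰⇒> j≰k))
    below′ : Below Claim (suc (m + k))
    below′ = subst (Below Claim) (sym j≡) below

  all-claims : ∀ n → Below Claim n
  all-claims = below-induction Claim claim-step

theorem2p1 : (k : ℕ) → 1 ≤ k → (A E : ℕ → ℕ) → IsASeq k A → IsESeq k E →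
             ∀ n → 2 ≤ n → A (E n) ≡ E (n ∸ 1)
theorem2p1 k k≥1 A E (A1 , A2 , rec) (E-init , E-rec) (suc j) (s≤s j≥1) =
  proj₁ (Main.all-claims k k≥1 A A1 A2 rec E E-init E-rec (suc j) j j≥1 ≤-refl)
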